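{- Let $n\ge2$ and let $T$ be the path with vertices $1,2,\ldots,n$ in order. Among all cycles arising as products of the edge-transpositions of $T$ over orderings of its edges, the ones of minimum multiplicity are exactly $(1,2,\ldots,n)$ and its inverse, and each of these is realised by exactly one ordering.
   Context: Each edge $\{i,i+1\}$ is regarded as the transposition $(i,i+1)$; an ordering lists every edge exactly once; the multiplicity of a cycle is the number of orderings whose product is that cycle. -}

module Defs where

open import Data.Nat as ℕ using (ℕ; zero; suc)
open import Data.Fin as Fin using (Fin; zero; suc; toℕ; fromℕ; inject₁; lower₁)
open import Data.Fin.Properties using () renaming (_≟_ to _≟F_)
open import Data.Bool using (if_then_else_)
open import Data.List using (List; []; _∷_; [_]; concatMap; map; filter; length; allFin)
open import Data.Vec as Vec using (Vec; []; _∷_; tabulate; toList)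
open import Data.Vec.Properties using (≡-dec)
import Data.List.Relation.Unary.Unique.DecPropositional as UDec
open import Relation.Nullary.Decidable using (⌊_⌋)
open import Relation.Binary.PropositionalEquality using (_≢_; sym)
open import Relation.Nullary using (yes; no)
open import Function using (id; _∘_)

-- Setting: n = suc m vertices (Fin (suc m), vertex k+1 of the paper is Fin index k),
-- edges of the path are Fin m; edge i = {i, i+1}.

transp : ∀ {n} → Fin n → Fin n → Fin n → Fin n
transp a b x = if ⌊ x ≟F a ⌋ then b else (if ⌊ x ≟F b ⌋ then a else x)

edgeTransp : ∀ {m} → Fin m → Fin (suc m) → Fin (suc m)
edgeTransp i = transp (inject₁ i) (suc i)

prod : ∀ {m k} → Vec (Fin m) k → Fin (suc m) → Fin (suc m)
prod []       = id
prod (e ∷ es) = edgeTransp e ∘ prod es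

allVecs : ∀ {A : Set} → List A → (k : ℕ) → List (Vec A k)
allVecs xs zero    = [ [] ]
allVecs xs (suc k) = concatMap (λ x → map (x ∷_) (allVecs xs k)) xs

orderings : (m : ℕ) → List (Vec (Fin m) m)
orderings m = filter (λ o → UDec.unique? (_≟F_ {m}) (toList o)) (allVecs (allFin m) m)

multiplicity : (m : ℕ) → (Fin (suc m) → Fin (suc m)) → ℕ
multiplicity m c =
  length (filter (λ o → ≡-dec _≟F_ (tabulate (prod o)) (tabulate c)) (orderings m))

-- the cycle (1,2,…,n): k ↦ k+1, n ↦ 1
cyc : ∀ {m} → Fin (suc m) → Fin (suc m)
cyc {m} i with toℕ i ℕ.≟ m
... | yes _ = zero
... | no ne = suc (lower₁ i (λ eq → ne (sym eq)))

cycInv : ∀ {m} → Fin (suc m) → Fin (suc m)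
cycInv {m} zero    = fromℕ m
cycInv {m} (suc i) = inject₁ i

-- Number the vertices 0, …, m and the edges 0, …, m − 1, edge e acting on ℕ as the
-- transposition (e e+1). A product of edge transpositions moves a point by at most one
-- per factor, so an ordering whose product sends m to 0, as (1 2 … n) does, must apply
-- the edges m − 1, …, 0 in this order; with only m factors this pins the ordering down.
-- Reversing an ordering inverts its product, which gives the same for the inverse cycle.
-- Any other ordering of the distinct edges has two consecutive non-adjacent edges, since
-- an ordering whose consecutive edges are always adjacent runs monotonically through
-- 0, …, m − 1. Non-adjacent transpositions commute, so swapping those two edges gives a
-- second ordering with the same product.
module Submission where

open import Defs
open import Data.Nat using (ℕ; zero; suc; _+_; _∸_; _<_; _≤_; z≤n; s≤s; _≟_)
open import Data.Nat.Properties
open import Data.Fin using (Fin; zero; suc; toℕ; fromℕ; inject₁; opposite)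
open import Data.Fin.Properties
  using (toℕ-injective; toℕ-inject₁; toℕ-fromℕ; toℕ-lower₁; toℕ<n; opposite-prop; opposite-involutive)
  renaming (_≟_ to _≟F_)
open import Data.Empty using (⊥-elim)
open import Data.Sum as Sum using (_⊎_; inj₁; inj₂)
open import Data.Product using (_×_; _,_; proj₂; ∃-syntax)
open import Data.List as List using (List; []; _∷_; _++_; [_]; reverse; length; allFin)
open import Data.List.Properties using (∷-injectiveˡ; unfold-reverse; reverse-involutive; length-reverse; length-map; map-injective)
open import Data.List.Membership.Propositional using (_∈_)
open import Data.List.Membership.Propositional.Properties using (∈-filter⁺; ∈-filter⁻; ∈-allFin; ∈-concatMap⁺; ∈-map⁺; ∈-map⁻)
open import Data.List.Relation.Binary.Disjoint.Propositional using (Disjoint)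
open import Data.List.Relation.Binary.Equality.Propositional using (≋⇒≡)
open import Data.List.Relation.Binary.Sublist.Propositional using (_⊆_; _∷_; _∷ʳ_; minimum)
open import Data.List.Relation.Binary.Sublist.Propositional.Properties using (to-≋; ∷ˡ⁻)
open import Data.List.Relation.Unary.All as All using (All; []; _∷_)
import Data.List.Relation.Unary.All.Properties as All
open import Data.List.Relation.Unary.AllPairs as AllPairs using ([]; _∷_)
import Data.List.Relation.Unary.AllPairs.Properties as AllPairs
open import Data.List.Relation.Unary.Any as Any using (here; there)
open import Data.List.Relation.Unary.Linked using (Linked; []; [-]; _∷_)
open import Data.List.Relation.Unary.Unique.Propositional using (Unique)
import Data.List.Relation.Unary.Unique.Propositional.Properties as Unique
import Data.List.Relation.Unary.Unique.DecPropositional as UniqueDec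
open import Data.Vec using (Vec; []; _∷_; tabulate; toList; lookup)
open import Data.Vec.Properties
  using (≡-dec; tabulate-cong; lookup∘tabulate; toList-injective; length-toList; cast-is-id)
  renaming (∷-injectiveˡ to ∷-injectiveˡᵛ; ∷-injectiveʳ to ∷-injectiveʳᵛ)
open import Function using (id; _∘_)
open import Relation.Binary.Definitions using (tri<; tri≈; tri>)
open import Relation.Binary.PropositionalEquality
  using (_≡_; _≢_; _≗_; ≢-sym; refl; sym; trans; cong; cong₂; subst; module ≡-Reasoning)
open import Relation.Nullary using (yes; no)

adjTransp : ℕ → ℕ → ℕ
adjTransp zero    zero             = 1
adjTransp zero    (suc zero)       = 0
adjTransp zero    z@(suc (suc _))  = z
adjTransp (suc e) zero             = zero
adjTransp (suc e) (suc z)          = suc (adjTransp e z)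

adjTransp-lower : ∀ e → adjTransp e e ≡ suc e
adjTransp-lower zero    = refl
adjTransp-lower (suc e) = cong suc (adjTransp-lower e)

adjTransp-upper : ∀ e → adjTransp e (suc e) ≡ e
adjTransp-upper zero    = refl
adjTransp-upper (suc e) = cong suc (adjTransp-upper e)

adjTransp-fixes : ∀ {e z} → z ≢ e → z ≢ suc e → adjTransp e z ≡ z
adjTransp-fixes {zero}  {zero}        z≢e _    = ⊥-elim (z≢e refl)
adjTransp-fixes {zero}  {suc zero}    _   z≢1  = ⊥-elim (z≢1 refl)
adjTransp-fixes {zero}  {suc (suc _)} _   _    = refl
adjTransp-fixes {suc e} {zero}        _   _    = refl
adjTransp-fixes {suc e} {suc z}       z≢e z≢e+1 =
  cong suc (adjTransp-fixes (z≢e ∘ cong suc) (z≢e+1 ∘ cong suc))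

adjTransp-fixes-< : ∀ {e z} → z < e → adjTransp e z ≡ z
adjTransp-fixes-< z<e = adjTransp-fixes (<⇒≢ z<e) (<⇒≢ (m<n⇒m<1+n z<e))

adjTransp-fixes-> : ∀ {e z} → suc e < z → adjTransp e z ≡ z
adjTransp-fixes-> e+1<z = adjTransp-fixes (>⇒≢ (<-trans (n<1+n _) e+1<z)) (>⇒≢ e+1<z)

data AdjView (e : ℕ) : ℕ → Set where
  lower : AdjView e e
  upper : AdjView e (suc e)
  away  : ∀ {z} → z ≢ e → z ≢ suc e → AdjView e z

adjView : ∀ e z → AdjView e z
adjView e z with z ≟ e | z ≟ suc e
... | yes refl | _        = lower
... | no _     | yes refl = upper
... | no z≢e   | no z≢e+1 = away z≢e z≢e+1

adjTransp-involutive : ∀ e z → adjTransp e (adjTransp e z) ≡ z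
adjTransp-involutive e z with adjView e z
... | lower rewrite adjTransp-lower e = adjTransp-upper e
... | upper rewrite adjTransp-upper e = adjTransp-lower e
... | away z≢e z≢e+1 rewrite adjTransp-fixes z≢e z≢e+1 = adjTransp-fixes z≢e z≢e+1

adjTransp-comm : ∀ {a b} → suc a < b → ∀ z → adjTransp a (adjTransp b z) ≡ adjTransp b (adjTransp a z)
adjTransp-comm {a} {b} a+1<b z with adjView a z
... | lower rewrite adjTransp-fixes-< (<-trans (n<1+n a) a+1<b) | adjTransp-lower a | adjTransp-fixes-< a+1<b = refl
... | upper rewrite adjTransp-fixes-< a+1<b | adjTransp-upper a | adjTransp-fixes-< (<-trans (n<1+n a) a+1<b) = refl
... | away z≢a z≢a+1 with adjView b z
...   | lower rewrite adjTransp-lower b | adjTransp-fixes-> (m<n⇒m<1+n a+1<b) | adjTransp-fixes-> a+1<b = sym (adjTransp-lower b)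
...   | upper rewrite adjTransp-upper b | adjTransp-fixes-> a+1<b | adjTransp-fixes-> (m<n⇒m<1+n a+1<b) = sym (adjTransp-upper b)
...   | away z≢b z≢b+1 rewrite adjTransp-fixes z≢b z≢b+1 | adjTransp-fixes z≢a z≢a+1 = sym (adjTransp-fixes z≢b z≢b+1)

Far : ℕ → ℕ → Set
Far a b = suc a < b ⊎ suc b < a

far⇒≢ : ∀ {a b} → Far a b → a ≢ b
far⇒≢ (inj₁ a+1<b) refl = <-irrefl refl (<-trans (n<1+n _) a+1<b)
far⇒≢ (inj₂ b+1<a) refl = <-irrefl refl (<-trans (n<1+n _) b+1<a)

adjTransp-comm-far : ∀ {a b} → Far a b → ∀ z → adjTransp a (adjTransp b z) ≡ adjTransp b (adjTransp a z)
adjTransp-comm-far (inj₁ a+1<b) z = adjTransp-comm a+1<b z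
adjTransp-comm-far (inj₂ b+1<a) z = sym (adjTransp-comm b+1<a z)

Adjacent : ℕ → ℕ → Set
Adjacent a b = b ≡ suc a ⊎ a ≡ suc b

far-or-adjacent : ∀ {a b} → a ≢ b → Far a b ⊎ Adjacent a b
far-or-adjacent {a} {b} a≢b with <-cmp a b
... | tri≈ _ a≡b _ = ⊥-elim (a≢b a≡b)
... | tri< a<b _ _ = Sum.map inj₁ (inj₁ ∘ sym) (m≤n⇒m<n∨m≡n a<b)
... | tri> _ _ b<a = Sum.map inj₂ (inj₂ ∘ sym) (m≤n⇒m<n∨m≡n b<a)

prodℕ : List ℕ → ℕ → ℕ
prodℕ []       = id
prodℕ (e ∷ es) = adjTransp e ∘ prodℕ es

prodℕ-++ : ∀ xs ys z → prodℕ (xs ++ ys) z ≡ prodℕ xs (prodℕ ys z)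
prodℕ-++ []       ys z = refl
prodℕ-++ (e ∷ xs) ys z = cong (adjTransp e) (prodℕ-++ xs ys z)

prodℕ-reverse : ∀ l z → prodℕ (reverse l) (prodℕ l z) ≡ z
prodℕ-reverse []      z = refl
prodℕ-reverse (e ∷ l) z = begin
  prodℕ (reverse (e ∷ l)) (adjTransp e (prodℕ l z))
    ≡⟨ cong (λ l′ → prodℕ l′ (adjTransp e (prodℕ l z))) (unfold-reverse e l) ⟩
  prodℕ (reverse l ++ [ e ]) (adjTransp e (prodℕ l z))
    ≡⟨ prodℕ-++ (reverse l) [ e ] _ ⟩
  prodℕ (reverse l) (adjTransp e (adjTransp e (prodℕ l z)))
    ≡⟨ cong (prodℕ (reverse l)) (adjTransp-involutive e _) ⟩
  prodℕ (reverse l) (prodℕ l z)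
    ≡⟨ prodℕ-reverse l z ⟩
  z ∎
  where open ≡-Reasoning

ascending : ℕ → ℕ → List ℕ
ascending a zero    = []
ascending a (suc k) = a ∷ ascending (suc a) k

descending : ℕ → ℕ → List ℕ
descending a zero    = []
descending a (suc k) = a + k ∷ descending a k

length-ascending : ∀ a k → length (ascending a k) ≡ k
length-ascending a zero    = refl
length-ascending a (suc k) = cong suc (length-ascending (suc a) k)

descending-snoc : ∀ a k → descending (suc a) k ++ [ a ] ≡ descending a (suc k)
descending-snoc a zero    = cong [_] (sym (+-identityʳ a))
descending-snoc a (suc k) = cong₂ _∷_ (sym (+-suc a k)) (descending-snoc a k)

reverse-ascending : ∀ a k → reverse (ascending a k) ≡ descending a k
reverse-ascending a zero    = refl
reverse-ascending a (suc k) = begin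
  reverse (a ∷ ascending (suc a) k)      ≡⟨ unfold-reverse a (ascending (suc a) k) ⟩
  reverse (ascending (suc a) k) ++ [ a ] ≡⟨ cong (_++ [ a ]) (reverse-ascending (suc a) k) ⟩
  descending (suc a) k ++ [ a ]          ≡⟨ descending-snoc a k ⟩
  descending a (suc k)                   ∎
  where open ≡-Reasoning

prodℕ-ascending-below : ∀ {a x} k → x < a → prodℕ (ascending a k) x ≡ x
prodℕ-ascending-below zero    x<a = refl
prodℕ-ascending-below {a} (suc k) x<a =
  trans (cong (adjTransp a) (prodℕ-ascending-below k (m<n⇒m<1+n x<a))) (adjTransp-fixes-< x<a)

prodℕ-ascending-inside : ∀ {a x} k → a ≤ x → x < a + k → prodℕ (ascending a k) x ≡ suc x
prodℕ-ascending-inside {a} {x} zero    a≤x x<a+0 = ⊥-elim (<⇒≱ x<a+0 (subst (_≤ x) (sym (+-identityʳ a)) a≤x))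
prodℕ-ascending-inside {a} {x} (suc k) a≤x x<a+k+1 with m≤n⇒m<n∨m≡n a≤x
... | inj₂ refl = trans (cong (adjTransp a) (prodℕ-ascending-below k (n<1+n a))) (adjTransp-lower a)
... | inj₁ a<x  = trans (cong (adjTransp a) (prodℕ-ascending-inside k a<x (subst (x <_) (+-suc a k) x<a+k+1)))
                        (adjTransp-fixes-> (s≤s a<x))

prodℕ-ascending-top : ∀ a k → prodℕ (ascending a k) (a + k) ≡ a
prodℕ-ascending-top a zero    = +-identityʳ a
prodℕ-ascending-top a (suc k) = begin
  adjTransp a (prodℕ (ascending (suc a) k) (a + suc k)) ≡⟨ cong (adjTransp a ∘ prodℕ (ascending (suc a) k)) (+-suc a k) ⟩
  adjTransp a (prodℕ (ascending (suc a) k) (suc a + k)) ≡⟨ cong (adjTransp a) (prodℕ-ascending-top (suc a) k) ⟩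
  adjTransp a (suc a)                                   ≡⟨ adjTransp-upper a ⟩
  a                                                     ∎
  where open ≡-Reasoning

prodℕ-descending : ∀ {x y} a k → prodℕ (ascending a k) x ≡ y → prodℕ (descending a k) y ≡ x
prodℕ-descending {x} a k refl = begin
  prodℕ (descending a k) (prodℕ (ascending a k) x)          ≡⟨ cong (λ l → prodℕ l (prodℕ (ascending a k) x)) (reverse-ascending a k) ⟨
  prodℕ (reverse (ascending a k)) (prodℕ (ascending a k) x) ≡⟨ prodℕ-reverse (ascending a k) x ⟩
  x                                                         ∎
  where open ≡-Reasoning

ascending-⊆ : ∀ l {x y} k → prodℕ l x ≡ y → y + k ≡ x → ascending y k ⊆ l
ascending-⊆ l        zero    _ _ = minimum l
ascending-⊆ []       {y = y} (suc k) refl y+k+1≡y = ⊥-elim (m+1+n≢m y y+k+1≡y)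
ascending-⊆ (e ∷ es) {x} (suc k) p q with prodℕ es x in eq | adjView e (prodℕ es x)
... | _ | lower with trans (sym (adjTransp-lower e)) p
...   | refl = e ∷ʳ ∷ˡ⁻ (ascending-⊆ es (suc (suc k)) eq (trans (+-suc e (suc k)) q))
ascending-⊆ (e ∷ es) {x} (suc k) p q | _ | upper with trans (sym (adjTransp-upper e)) p
...   | refl = refl ∷ ascending-⊆ es k eq (trans (sym (+-suc e k)) q)
ascending-⊆ (e ∷ es) {x} (suc k) p q | _ | away z≢e z≢e+1 =
  e ∷ʳ ascending-⊆ es (suc k) (trans eq (trans (sym (adjTransp-fixes z≢e z≢e+1)) p)) q

ascending-unique : ∀ l k → length l ≡ k → prodℕ l k ≡ 0 → l ≡ ascending 0 k
ascending-unique l k len p =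
  sym (≋⇒≡ (to-≋ (trans (length-ascending 0 k) (sym len)) (ascending-⊆ l k p refl)))

descending-unique : ∀ l k → length l ≡ k → prodℕ l 0 ≡ k → l ≡ descending 0 k
descending-unique l k len p = begin
  l                       ≡⟨ reverse-involutive l ⟨
  reverse (reverse l)     ≡⟨ cong reverse (ascending-unique (reverse l) k (trans (length-reverse l) len) reversed) ⟩
  reverse (ascending 0 k) ≡⟨ reverse-ascending 0 k ⟩
  descending 0 k          ∎
  where
  open ≡-Reasoning
  reversed : prodℕ (reverse l) k ≡ 0
  reversed = trans (cong (prodℕ (reverse l)) (sym p)) (prodℕ-reverse l 0)

ascending-run : ∀ x r → Linked Adjacent (x ∷ suc x ∷ r) → Unique (x ∷ suc x ∷ r) →
                x ∷ suc x ∷ r ≡ ascending x (2 + length r)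
ascending-run x []      _                          _                   = refl
ascending-run x (z ∷ r) (_ ∷ inj₁ refl ∷ adj)      (_ ∷ u)             = cong (x ∷_) (ascending-run (suc x) r (inj₁ refl ∷ adj) u)
ascending-run x (z ∷ r) (_ ∷ inj₂ x+1≡z+1 ∷ _)     ((_ ∷ x≢z ∷ _) ∷ _) = ⊥-elim (x≢z (suc-injective x+1≡z+1))

descending-run : ∀ y r → Linked Adjacent (suc y ∷ y ∷ r) → Unique (suc y ∷ y ∷ r) →
                 ∃[ a ] suc y ∷ y ∷ r ≡ descending a (2 + length r)
descending-run y []      _                     _                     = y , cong₂ _∷_ (+-comm 1 y) (cong [_] (sym (+-identityʳ y)))
descending-run y (z ∷ r) (_ ∷ inj₁ refl ∷ _)   ((_ ∷ y+1≢z ∷ _) ∷ _) = ⊥-elim (y+1≢z refl)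
descending-run y (z ∷ r) (_ ∷ inj₂ refl ∷ adj) (_ ∷ u) with descending-run z r (inj₂ refl ∷ adj) u
... | a , eq = a , cong₂ _∷_ (trans (cong suc (∷-injectiveˡ eq)) (sym (+-suc a (suc (length r))))) eq

unique-adjacent-run : ∀ l → Linked Adjacent l → Unique l →
                      (∃[ a ] l ≡ ascending a (length l)) ⊎ (∃[ a ] l ≡ descending a (length l))
unique-adjacent-run []          _                   _ = inj₁ (0 , refl)
unique-adjacent-run (x ∷ [])    _                   _ = inj₁ (x , refl)
unique-adjacent-run (x ∷ _ ∷ r) adj@(inj₁ refl ∷ _) u = inj₁ (x , ascending-run x r adj u)
unique-adjacent-run (_ ∷ y ∷ r) adj@(inj₂ refl ∷ _) u = inj₂ (descending-run y r adj u)

m+n<1+n⇒m≡0 : ∀ m n → m + n < suc n → m ≡ 0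
m+n<1+n⇒m≡0 m n (s≤s m+n≤n) = n≤0⇒n≡0 (+-cancelʳ-≤ n m 0 m+n≤n)

ascending-top-< : ∀ {m} a k → All (_< m) (ascending a (suc k)) → a + k < m
ascending-top-< {m} a zero    (a<m ∷ _)   = subst (_< m) (sym (+-identityʳ a)) a<m
ascending-top-< {m} a (suc k) (_ ∷ top<m) = subst (_< m) (sym (+-suc a k)) (ascending-top-< (suc a) k top<m)

ascending-bounded : ∀ a k → All (_< k) (ascending a k) → ascending a k ≡ ascending 0 k
ascending-bounded a zero    _           = refl
ascending-bounded a (suc k) entries<k+1 =
  cong (λ b → ascending b (suc k)) (m+n<1+n⇒m≡0 a k (ascending-top-< a k entries<k+1))

descending-bounded : ∀ a k → All (_< k) (descending a k) → descending a k ≡ descending 0 k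
descending-bounded a zero    _             = refl
descending-bounded a (suc k) (top<k+1 ∷ _) = cong (λ b → descending b (suc k)) (m+n<1+n⇒m≡0 a k top<k+1)

unique-adjacent-bounded : ∀ {k} l → Linked Adjacent l → Unique l → length l ≡ k → All (_< k) l →
                          l ≡ ascending 0 k ⊎ l ≡ descending 0 k
unique-adjacent-bounded l adj u refl entries<k with unique-adjacent-run l adj u
... | inj₁ (a , eq) = inj₁ (trans eq (ascending-bounded a (length l) (subst (All (_< length l)) eq entries<k)))
... | inj₂ (a , eq) = inj₂ (trans eq (descending-bounded a (length l) (subst (All (_< length l)) eq entries<k)))

indices : ∀ {m k} → Vec (Fin m) k → List ℕ
indices o = List.map toℕ (toList o)

length-indices : ∀ {m k} (o : Vec (Fin m) k) → length (indices o) ≡ k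
length-indices o = trans (length-map toℕ (toList o)) (length-toList o)

indices-< : ∀ {m k} (o : Vec (Fin m) k) → All (_< m) (indices o)
indices-< []      = []
indices-< (e ∷ o) = toℕ<n e ∷ indices-< o

indices-injective : ∀ {m k} {o o′ : Vec (Fin m) k} → indices o ≡ indices o′ → o ≡ o′
indices-injective {o = o} {o′} eq =
  trans (sym (cast-is-id refl o)) (toList-injective refl o o′ (map-injective toℕ-injective eq))

toℕ-edgeTransp : ∀ {m} (e : Fin m) x → toℕ (edgeTransp e x) ≡ adjTransp (toℕ e) (toℕ x)
toℕ-edgeTransp e x with x ≟F inject₁ e | x ≟F suc e
... | yes refl | _ = begin
  suc (toℕ e)                         ≡⟨ adjTransp-lower (toℕ e) ⟨
  adjTransp (toℕ e) (toℕ e)           ≡⟨ cong (adjTransp (toℕ e)) (toℕ-inject₁ e) ⟨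
  adjTransp (toℕ e) (toℕ (inject₁ e)) ∎
  where open ≡-Reasoning
... | no _ | yes refl = trans (toℕ-inject₁ e) (sym (adjTransp-upper (toℕ e)))
... | no x≢e | no x≢e+1 = sym (adjTransp-fixes (λ eq → x≢e (toℕ-injective (trans eq (sym (toℕ-inject₁ e)))))
                                               (λ eq → x≢e+1 (toℕ-injective eq)))

toℕ-prod : ∀ {m k} (o : Vec (Fin m) k) x → toℕ (prod o x) ≡ prodℕ (indices o) (toℕ x)
toℕ-prod []      x = refl
toℕ-prod (e ∷ o) x = trans (toℕ-edgeTransp e (prod o x)) (cong (adjTransp (toℕ e)) (toℕ-prod o x))

Realises : ∀ {m} → List ℕ → (Fin (suc m) → Fin (suc m)) → Set
Realises l c = ∀ i → toℕ (c i) ≡ prodℕ l (toℕ i)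

cyc-realised : ∀ {m} → Realises (ascending 0 m) (cyc {m})
cyc-realised {m} i with toℕ i ≟ m
... | yes i≡m = sym (trans (cong (prodℕ (ascending 0 m)) i≡m) (prodℕ-ascending-top 0 m))
... | no i≢m  = trans (cong suc (toℕ-lower₁ i _)) (sym (prodℕ-ascending-inside m z≤n (≤∧≢⇒< (≤-pred (toℕ<n i)) i≢m)))

cycInv-realised : ∀ {m} → Realises (descending 0 m) (cycInv {m})
cycInv-realised {m} zero    = trans (toℕ-fromℕ m) (sym (prodℕ-descending 0 m (prodℕ-ascending-top 0 m)))
cycInv-realised {m} (suc i) = trans (toℕ-inject₁ i) (sym (prodℕ-descending 0 m (prodℕ-ascending-inside m z≤n (toℕ<n i))))

prod-≗ : ∀ {m k} (o : Vec (Fin m) k) {l} {c : Fin (suc m) → Fin (suc m)} →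
         Realises l c → indices o ≡ l → prod o ≗ c
prod-≗ o c-realised refl i = toℕ-injective (trans (toℕ-prod o i) (sym (c-realised i)))

prodℕ-indices-≗ : ∀ {m k} (o : Vec (Fin m) k) {l} {c : Fin (suc m) → Fin (suc m)} →
                  Realises l c → prod o ≗ c → ∀ i → prodℕ (indices o) (toℕ i) ≡ prodℕ l (toℕ i)
prodℕ-indices-≗ o c-realised o≗c i = trans (sym (toℕ-prod o i)) (trans (cong toℕ (o≗c i)) (c-realised i))

indices-of-cyc : ∀ {m} (o : Vec (Fin m) m) → prod o ≗ cyc → indices o ≡ ascending 0 m
indices-of-cyc {m} o o≗cyc = ascending-unique (indices o) m (length-indices o) (begin
  prodℕ (indices o) m                    ≡⟨ cong (prodℕ (indices o)) (toℕ-fromℕ m) ⟨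
  prodℕ (indices o) (toℕ (fromℕ m))     ≡⟨ prodℕ-indices-≗ o {ascending 0 m} cyc-realised o≗cyc (fromℕ m) ⟩
  prodℕ (ascending 0 m) (toℕ (fromℕ m))  ≡⟨ cong (prodℕ (ascending 0 m)) (toℕ-fromℕ m) ⟩
  prodℕ (ascending 0 m) m                ≡⟨ prodℕ-ascending-top 0 m ⟩
  0                                      ∎)
  where open ≡-Reasoning

indices-of-cycInv : ∀ {m} (o : Vec (Fin m) m) → prod o ≗ cycInv → indices o ≡ descending 0 m
indices-of-cycInv {m} o o≗cycInv = descending-unique (indices o) m (length-indices o)
  (trans (prodℕ-indices-≗ o {descending 0 m} cycInv-realised o≗cycInv zero) (prodℕ-descending 0 m (prodℕ-ascending-top 0 m)))

toList-tabulate : ∀ {A : Set} {k} (f : Fin k → A) → toList (tabulate f) ≡ List.tabulate f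
toList-tabulate {k = zero}  f = refl
toList-tabulate {k = suc k} f = cong (f zero ∷_) (toList-tabulate (f ∘ suc))

tabulate-unique : ∀ {A : Set} {k} {f : Fin k → A} → (∀ {i j} → f i ≡ f j → i ≡ j) → Unique (toList (tabulate f))
tabulate-unique {f = f} f-injective = subst Unique (sym (toList-tabulate f)) (Unique.tabulate⁺ f-injective)

indices-tabulate-ascending : ∀ {m k} a (f : Fin k → Fin m) → (∀ i → toℕ (f i) ≡ a + toℕ i) →
                             indices (tabulate f) ≡ ascending a k
indices-tabulate-ascending {k = zero}  a f f-values = refl
indices-tabulate-ascending {k = suc k} a f f-values = cong₂ _∷_ (trans (f-values zero) (+-identityʳ a))
  (indices-tabulate-ascending (suc a) (f ∘ suc) (λ i → trans (f-values (suc i)) (+-suc a (toℕ i))))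

indices-tabulate-descending : ∀ {m k} (f : Fin k → Fin m) → (∀ i → toℕ (f i) ≡ k ∸ suc (toℕ i)) →
                              indices (tabulate f) ≡ descending 0 k
indices-tabulate-descending {k = zero}  f f-values = refl
indices-tabulate-descending {k = suc k} f f-values = cong₂ _∷_ (f-values zero) (indices-tabulate-descending (f ∘ suc) (f-values ∘ suc))

increasing : ∀ m → Vec (Fin m) m
increasing m = tabulate id

decreasing : ∀ m → Vec (Fin m) m
decreasing m = tabulate opposite

indices-increasing : ∀ m → indices (increasing m) ≡ ascending 0 m
indices-increasing m = indices-tabulate-ascending 0 id (λ _ → refl)

indices-decreasing : ∀ m → indices (decreasing m) ≡ descending 0 m
indices-decreasing m = indices-tabulate-descending opposite opposite-prop

increasing-unique : ∀ m → Unique (toList (increasing m))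
increasing-unique m = tabulate-unique id

decreasing-unique : ∀ m → Unique (toList (decreasing m))
decreasing-unique m = tabulate-unique (λ {i} {j} eq → trans (sym (opposite-involutive i)) (trans (cong opposite eq) (opposite-involutive j)))

data FarSwap {m} : ∀ {k} → Vec (Fin m) k → Vec (Fin m) k → Set where
  here  : ∀ {k a b} {o : Vec (Fin m) k} → Far (toℕ a) (toℕ b) → FarSwap (a ∷ b ∷ o) (b ∷ a ∷ o)
  there : ∀ {k e} {o o′ : Vec (Fin m) k} → FarSwap o o′ → FarSwap (e ∷ o) (e ∷ o′)

prod-farSwap : ∀ {m k} {o o′ : Vec (Fin m) k} → FarSwap o o′ → prod o ≗ prod o′
prod-farSwap (here {a = a} {b} {o} far) x = toℕ-injective (begin
  toℕ (prod (a ∷ b ∷ o) x)                                          ≡⟨ toℕ-prod (a ∷ b ∷ o) x ⟩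
  adjTransp (toℕ a) (adjTransp (toℕ b) (prodℕ (indices o) (toℕ x))) ≡⟨ adjTransp-comm-far far _ ⟩
  adjTransp (toℕ b) (adjTransp (toℕ a) (prodℕ (indices o) (toℕ x))) ≡⟨ toℕ-prod (b ∷ a ∷ o) x ⟨
  toℕ (prod (b ∷ a ∷ o) x)                                          ∎)
  where open ≡-Reasoning
prod-farSwap (there {e = e} s) x = cong (edgeTransp e) (prod-farSwap s x)

farSwap-≢ : ∀ {m k} {o o′ : Vec (Fin m) k} → FarSwap o o′ → o ≢ o′
farSwap-≢ (here far) eq = far⇒≢ far (cong toℕ (∷-injectiveˡᵛ eq))
farSwap-≢ (there s)  eq = farSwap-≢ s (∷-injectiveʳᵛ eq)

farSwap-All : ∀ {m k} {P : Fin m → Set} {o o′ : Vec (Fin m) k} → FarSwap o o′ → All P (toList o) → All P (toList o′)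
farSwap-All (here _)  (pa ∷ pb ∷ ps) = pb ∷ pa ∷ ps
farSwap-All (there s) (p ∷ ps)       = p ∷ farSwap-All s ps

farSwap-unique : ∀ {m k} {o o′ : Vec (Fin m) k} → FarSwap o o′ → Unique (toList o) → Unique (toList o′)
farSwap-unique (here _)  ((a≢b ∷ a∉o) ∷ b∉o ∷ u) = (≢-sym a≢b ∷ b∉o) ∷ a∉o ∷ u
farSwap-unique (there s) (e∉o ∷ u)               = farSwap-All s e∉o ∷ farSwap-unique s u

farSwap-or-adjacent : ∀ {m k} (o : Vec (Fin m) k) → Unique (toList o) →
                      (∃[ o′ ] FarSwap o o′) ⊎ Linked Adjacent (indices o)
farSwap-or-adjacent []          _ = inj₂ []
farSwap-or-adjacent (a ∷ [])    _ = inj₂ [-]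
farSwap-or-adjacent (a ∷ b ∷ o) ((a≢b ∷ _) ∷ u) with far-or-adjacent (a≢b ∘ toℕ-injective)
... | inj₁ far = inj₁ (_ , here far)
... | inj₂ adj with farSwap-or-adjacent (b ∷ o) u
...   | inj₁ (o′ , s) = inj₁ (_ , there s)
...   | inj₂ linked   = inj₂ (adj ∷ linked)

allVecs-complete : ∀ {A : Set} (xs : List A) → (∀ a → a ∈ xs) → ∀ {k} (v : Vec A k) → v ∈ allVecs xs k
allVecs-complete xs xs-complete         []      = here refl
allVecs-complete xs xs-complete {suc k} (a ∷ v) =
  ∈-concatMap⁺ (λ x → List.map (x ∷_) (allVecs xs k)) (Any.map (λ { refl → ∈-map⁺ (a ∷_) (allVecs-complete xs xs-complete v) }) (xs-complete a))

allVecs-unique : ∀ {A : Set} {xs : List A} → Unique xs → ∀ k → Unique (allVecs xs k)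
allVecs-unique           u zero    = [] ∷ []
allVecs-unique {xs = xs} u (suc k) =
  Unique.concat⁺ (All.map⁺ (All.universal (λ x → Unique.map⁺ ∷-injectiveʳᵛ (allVecs-unique u k)) xs))
                 (AllPairs.map⁺ (AllPairs.map disjoint u))
  where
  disjoint : ∀ {x y} → x ≢ y → Disjoint (List.map (x ∷_) (allVecs xs k)) (List.map (y ∷_) (allVecs xs k))
  disjoint x≢y (v∈x , v∈y) with ∈-map⁻ _ v∈x | ∈-map⁻ _ v∈y
  ... | _ , _ , refl | _ , _ , eq = x≢y (∷-injectiveˡᵛ eq)

∈-orderings : ∀ {m} (o : Vec (Fin m) m) → Unique (toList o) → o ∈ orderings m
∈-orderings {m} o u = ∈-filter⁺ (λ o → UniqueDec.unique? _≟F_ (toList o)) (allVecs-complete (allFin m) ∈-allFin o) u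

orderings-unique : ∀ m → Unique (orderings m)
orderings-unique m = Unique.filter⁺ (λ o → UniqueDec.unique? _≟F_ (toList o)) (allVecs-unique (Unique.allFin⁺ m) m)

tabulate-injective : ∀ {A : Set} {k} {f g : Fin k → A} → tabulate f ≡ tabulate g → f ≗ g
tabulate-injective {f = f} {g} eq i = trans (sym (lookup∘tabulate f i)) (trans (cong (λ v → lookup v i) eq) (lookup∘tabulate g i))

length≡1 : ∀ {A : Set} {xs : List A} {x} → Unique xs → x ∈ xs → (∀ {y} → y ∈ xs → y ≡ x) → length xs ≡ 1
length≡1 {xs = _ ∷ []}    _               _ _     = refl
length≡1 {xs = _ ∷ _ ∷ _} ((y≢z ∷ _) ∷ _) _ all≡x = ⊥-elim (y≢z (trans (all≡x (here refl)) (sym (all≡x (there (here refl))))))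

2≤length : ∀ {A : Set} {xs : List A} {x y} → x ∈ xs → y ∈ xs → x ≢ y → 2 ≤ length xs
2≤length                  (here refl)  (here refl)  x≢y = ⊥-elim (x≢y refl)
2≤length {xs = _ ∷ _ ∷ _} (here _)     (there _)    _   = s≤s (s≤s z≤n)
2≤length {xs = _ ∷ _ ∷ _} (there _)    (here _)     _   = s≤s (s≤s z≤n)
2≤length                  (there x∈xs) (there y∈xs) x≢y = m≤n⇒m≤1+n (2≤length x∈xs y∈xs x≢y)

multiplicity≡1 : ∀ {m} {c : Fin (suc m) → Fin (suc m)} (v : Vec (Fin m) m) → Unique (toList v) → prod v ≗ c →
                 (∀ w → prod w ≗ c → w ≡ v) → multiplicity m c ≡ 1
multiplicity≡1 {m} {c} v u v≗c only-v =
  length≡1 (Unique.filter⁺ P? (orderings-unique m))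
           (∈-filter⁺ P? (∈-orderings v u) (tabulate-cong v≗c))
           (λ {w} w∈ → only-v w (tabulate-injective (proj₂ (∈-filter⁻ P? {xs = orderings m} w∈))))
  where
  P? = λ (w : Vec (Fin m) m) → ≡-dec _≟F_ (tabulate (prod w)) (tabulate c)

2≤multiplicity : ∀ {m} {o o′ : Vec (Fin m) m} → Unique (toList o) → Unique (toList o′) → o ≢ o′ →
                 prod o′ ≗ prod o → 2 ≤ multiplicity m (prod o)
2≤multiplicity {m} {o} {o′} u u′ o≢o′ o′≗o =
  2≤length (∈-filter⁺ P? (∈-orderings o u) refl) (∈-filter⁺ P? (∈-orderings o′ u′) (tabulate-cong o′≗o)) o≢o′
  where
  P? = λ (w : Vec (Fin m) m) → ≡-dec _≟F_ (tabulate (prod w)) (tabulate (prod o))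

multiplicity-cyc : ∀ m → multiplicity m cyc ≡ 1
multiplicity-cyc m =
  multiplicity≡1 (increasing m) (increasing-unique m) (prod-≗ (increasing m) cyc-realised (indices-increasing m))
    (λ w w≗cyc → indices-injective (trans (indices-of-cyc w w≗cyc) (sym (indices-increasing m))))

multiplicity-cycInv : ∀ m → multiplicity m cycInv ≡ 1
multiplicity-cycInv m =
  multiplicity≡1 (decreasing m) (decreasing-unique m) (prod-≗ (decreasing m) cycInv-realised (indices-decreasing m))
    (λ w w≗cycInv → indices-injective (trans (indices-of-cycInv w w≗cycInv) (sym (indices-decreasing m))))

2≤multiplicity-of-other : ∀ {m} (o : Vec (Fin m) m) → Unique (toList o) →
                          tabulate (prod o) ≢ tabulate cyc → tabulate (prod o) ≢ tabulate cycInv → 2 ≤ multiplicity m (prod o)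
2≤multiplicity-of-other {m} o u o≢cyc o≢cycInv with farSwap-or-adjacent o u
... | inj₁ (o′ , s) = 2≤multiplicity u (farSwap-unique s u) (farSwap-≢ s) (sym ∘ prod-farSwap s)
... | inj₂ linked with unique-adjacent-bounded (indices o) linked (Unique.map⁺ toℕ-injective u) (length-indices o) (indices-< o)
...   | inj₁ ascending-indices  = ⊥-elim (o≢cyc (tabulate-cong (prod-≗ o cyc-realised ascending-indices)))
...   | inj₂ descending-indices = ⊥-elim (o≢cycInv (tabulate-cong (prod-≗ o cycInv-realised descending-indices)))

proposition3p13 : (m : ℕ) → 1 ≤ m →
    multiplicity m cyc ≡ 1 × multiplicity m cycInv ≡ 1 ×
    ((o : Vec (Fin m) m) → Unique (toList o) →
      tabulate (prod o) ≢ tabulate cyc → tabulate (prod o) ≢ tabulate cycInv →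
      2 ≤ multiplicity m (prod o))
proposition3p13 m _ = multiplicity-cyc m , multiplicity-cycInv m , 2≤multiplicity-of-other
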